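{- Let $p\ge 3$ and $0<r_1<p$ be coprime integers. Put $r_0=p$ and for $1\le i\le t$ define integers $Z_i$, $r_{i+1}$ by $r_{i-1}=Z_ir_i+r_{i+1}$, $0\le r_{i+1}<r_i$, where $t$ is the index with $r_t=1$ (so $r_{t+1}=0$). Let $\mathcal{Z}$ be the set of integer $t$-tuples $\mathbf z=(z_1,\dots,z_t)$ with $0\le z_i\le Z_i$ for all $i$, which are either $\mathbf 0$ or satisfy: (i) the smallest index $i$ with $z_i>0$ is odd, and (ii) $0\le z_t\le Z_t-1$. For $\mathbf z\in\mathcal{Z}$ put $R(\mathbf z)=\sum_{1\le i\le t}z_i(-1)^{i-1}r_i$. Then every integer $n$ with $0\le n<p$ can be written as $n=R(\mathbf z)$ for some $\mathbf z\in\mathcal{Z}$. -}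

module Defs where

open import Data.Nat using (ℕ; zero; suc; _+_; _*_; _∸_; _≤_; _<_; _%_)
open import Data.Nat.Coprimality using (Coprime)
open import Data.Integer using (ℤ; +_; -1ℤ; _^_) renaming (_+_ to _+ℤ_; _*_ to _*ℤ_)
open import Data.Product using (_×_; Σ; ∃)
open import Data.Sum using (_⊎_)
open import Relation.Binary.PropositionalEquality using (_≡_)

-- Sequences are modelled as functions ℕ → ℕ; only the indices named in the
-- paper are constrained / used.

IsEuclid : ℕ → ℕ → ℕ → (ℕ → ℕ) → (ℕ → ℕ) → Set
IsEuclid p r₁ t r Z =
  (r 0 ≡ p) × (r 1 ≡ r₁) × (r t ≡ 1) ×
  (∀ i → 1 ≤ i → i ≤ t → (r (i ∸ 1) ≡ Z i * r i + r (suc i)) × (r (suc i) < r i))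

FirstNonzeroAt : ℕ → (ℕ → ℕ) → ℕ → Set
FirstNonzeroAt t z j =
  (1 ≤ j) × (j ≤ t) × (0 < z j) × (∀ i → 1 ≤ i → i < j → z i ≡ 0)

InZ : ℕ → (ℕ → ℕ) → (ℕ → ℕ) → Set
InZ t Z z =
  (∀ i → 1 ≤ i → i ≤ t → z i ≤ Z i) ×
  ( (∀ i → 1 ≤ i → i ≤ t → z i ≡ 0)
  ⊎ ( (∃ λ j → FirstNonzeroAt t z j × (j % 2 ≡ 1))
    × (z t ≤ Z t ∸ 1) ) )

R : ℕ → (ℕ → ℕ) → (ℕ → ℕ) → ℤ
R zero      z r = + 0
R (suc k) z r = R k z r +ℤ (+ (z (suc k)) *ℤ ((-1ℤ ^ k) *ℤ (+ r (suc k))))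

{-# OPTIONS --safe #-}
-- Downward induction on the position: every n < r_j is the alternating sum
-- z_{j+1} r_{j+1} - z_{j+2} r_{j+2} + ... of an admissible tail, with z_{j+1} > 0 when n > 0.
-- Since r_j = Z_{j+1} r_{j+1} + r_{j+2}, either n ≤ Z_{j+1} r_{j+1}, and then
-- n = c r_{j+1} - e with c = ⌈n / r_{j+1}⌉ and e < r_{j+1} represented from position j + 2,
-- or n = Z_{j+1} r_{j+1} + e with e < r_{j+2} represented from position j + 3.
module Submission where

open import Defs
open import Data.Nat using (ℕ; zero; suc; _+_; _*_; _∸_; _≤_; _<_; z≤n; s≤s; _≟_; _≤?_)
open import Data.Nat.Properties
open import Data.Nat.Coprimality using (Coprime)
open import Data.Integer using (+_; -1ℤ; _^_) renaming (_+_ to _+ℤ_; _*_ to _*ℤ_)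
import Data.Integer.Properties as ℤ
open import Data.Integer.Tactic.RingSolver using (solve-∀)
open import Data.Product using (_×_; ∃; ∃₂; _,_; proj₁; proj₂)
open import Data.Sum using (inj₁; inj₂)
open import Data.Empty using (⊥-elim)
open import Relation.Nullary using (yes; no)
open import Relation.Binary.PropositionalEquality

_⊕_ : (ℕ → ℕ) → (ℕ → ℕ) → ℕ → ℕ
(z ⊕ w) i = z i + w i

single : ℕ → ℕ → ℕ → ℕ
single k c i with i ≟ k
... | yes _ = c
... | no  _ = 0

single-same : ∀ k c → single k c k ≡ c
single-same k c with k ≟ k
... | yes _   = refl
... | no  k≢k = ⊥-elim (k≢k refl)

single-other : ∀ {k c i} → i ≢ k → single k c i ≡ 0
single-other {k} {i = i} i≢k with i ≟ k
... | yes i≡k = ⊥-elim (i≢k i≡k)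
... | no  _   = refl

single-≤ : ∀ {k c} (f : ℕ → ℕ) i → c ≤ f k → single k c i ≤ f i
single-≤ {k} f i c≤fk with i ≟ k
... | yes refl = c≤fk
... | no  _    = z≤n

R-vanishes : ∀ k z r → (∀ i → 0 < i → i ≤ k → z i ≡ 0) → R k z r ≡ + 0
R-vanishes zero    z r _   = refl
R-vanishes (suc k) z r z≡0
  rewrite R-vanishes k z r (λ i 0<i i≤k → z≡0 i 0<i (m≤n⇒m≤1+n i≤k))
        | z≡0 (suc k) (s≤s z≤n) ≤-refl = refl

R-⊕ : ∀ k z w r → R k (z ⊕ w) r ≡ R k z r +ℤ R k w r
R-⊕ zero    z w r = refl
R-⊕ (suc k) z w r
  rewrite R-⊕ k z w r | ℤ.pos-+ (z (suc k)) (w (suc k)) =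
  distrib (R k z r) (R k w r) (+ z (suc k)) (+ w (suc k)) (-1ℤ ^ k *ℤ + r (suc k))
  where
  distrib : ∀ a b x y u → (a +ℤ b) +ℤ (x +ℤ y) *ℤ u ≡ (a +ℤ x *ℤ u) +ℤ (b +ℤ y *ℤ u)
  distrib = solve-∀

R-single : ∀ k j c r → suc j ≤ k → R k (single (suc j) c) r ≡ -1ℤ ^ j *ℤ + (c * r (suc j))
R-single (suc k) j c r (s≤s j≤k) with j ≟ k
... | yes refl = begin
  R j (single (suc j) c) r +ℤ + single (suc j) c (suc j) *ℤ (-1ℤ ^ j *ℤ + r (suc j))
    ≡⟨ cong₂ (λ a x → a +ℤ + x *ℤ (-1ℤ ^ j *ℤ + r (suc j)))
             (R-vanishes j _ r (λ i _ i≤j → single-other (<⇒≢ (s≤s i≤j))))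
             (single-same (suc j) c) ⟩
  + 0 +ℤ + c *ℤ (-1ℤ ^ j *ℤ + r (suc j))
    ≡⟨ ℤ.+-identityˡ _ ⟩
  + c *ℤ (-1ℤ ^ j *ℤ + r (suc j))
    ≡⟨ swap (+ c) (-1ℤ ^ j) (+ r (suc j)) ⟩
  -1ℤ ^ j *ℤ (+ c *ℤ + r (suc j))
    ≡⟨ cong (-1ℤ ^ j *ℤ_) (sym (ℤ.pos-* c (r (suc j)))) ⟩
  -1ℤ ^ j *ℤ + (c * r (suc j)) ∎
  where
  open ≡-Reasoning
  swap : ∀ x s y → x *ℤ (s *ℤ y) ≡ s *ℤ (x *ℤ y)
  swap = solve-∀
... | no j≢k
  rewrite R-single k j c r (≤∧≢⇒< j≤k j≢k)
        | single-other {suc j} {c} {suc k} (λ k≡j → j≢k (sym (suc-injective k≡j))) =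
  ℤ.+-identityʳ _

alternating-cancel : ∀ j n e → -1ℤ ^ j *ℤ + (n + e) +ℤ -1ℤ ^ suc j *ℤ + e ≡ -1ℤ ^ j *ℤ + n
alternating-cancel j n e rewrite ℤ.pos-+ n e = cancel (-1ℤ ^ j) (+ n) (+ e)
  where
  cancel : ∀ s x y → s *ℤ (x +ℤ y) +ℤ (-1ℤ *ℤ s) *ℤ y ≡ s *ℤ x
  cancel = solve-∀

alternating-add : ∀ j m e → -1ℤ ^ j *ℤ + m +ℤ -1ℤ ^ suc (suc j) *ℤ + e ≡ -1ℤ ^ j *ℤ + (m + e)
alternating-add j m e rewrite ℤ.pos-+ m e = add (-1ℤ ^ j) (+ m) (+ e)
  where
  add : ∀ s x y → s *ℤ x +ℤ (-1ℤ *ℤ (-1ℤ *ℤ s)) *ℤ y ≡ s *ℤ (x +ℤ y)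
  add = solve-∀

ceiling-multiple : ∀ {a} → 0 < a → ∀ q n → n ≤ q * a →
                   ∃₂ λ c e → c ≤ q × c * a ≡ n + e × e < a × (0 < n → 0 < c)
ceiling-multiple 0<a zero zero z≤n = 0 , 0 , z≤n , refl , 0<a , λ ()
ceiling-multiple {a} 0<a (suc q) n n≤[1+q]a with n ≤? q * a
... | yes n≤qa =
  let c , e , c≤q , ca≡n+e , e<a , c-pos = ceiling-multiple 0<a q n n≤qa
  in  c , e , m≤n⇒m≤1+n c≤q , ca≡n+e , e<a , c-pos
... | no n≰qa with m≤n⇒∃[o]m+o≡n n≤[1+q]a
...   | e , n+e≡[1+q]a = suc q , e , ≤-refl , sym n+e≡[1+q]a , e<a , λ _ → s≤s z≤n
  where
  open ≤-Reasoning
  e<a : e < a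
  e<a = +-cancelˡ-< n e a (begin-strict
    n + e   ≡⟨ n+e≡[1+q]a ⟩
    a + q * a <⟨ +-monoʳ-< a (≰⇒> n≰qa) ⟩
    a + n   ≡⟨ +-comm a n ⟩
    n + a   ∎)

module Representation {t : ℕ} {r Z : ℕ → ℕ}
  (division : ∀ i → 1 ≤ i → i ≤ t → (r (i ∸ 1) ≡ Z i * r i + r (suc i)) × (r (suc i) < r i))
  (r1<r0 : r 1 < r 0) (rt≡1 : r t ≡ 1) where

  division-step : ∀ {j} → j < t → r j ≡ Z (suc j) * r (suc j) + r (suc (suc j))
  division-step j<t = proj₁ (division _ (s≤s z≤n) j<t)

  next-remainder-smaller : ∀ {j} → j < t → r (suc (suc j)) < r (suc j)
  next-remainder-smaller j<t = proj₂ (division _ (s≤s z≤n) j<t)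

  remainder-smaller : ∀ {j} → j < t → r (suc j) < r j
  remainder-smaller {zero}  _   = r1<r0
  remainder-smaller {suc j} j<t = next-remainder-smaller (<⇒≤ j<t)

  quotient-positive : ∀ {j} → j < t → 0 < Z (suc j)
  quotient-positive {j} j<t with Z (suc j) | division-step j<t
  ... | zero  | rⱼ≡rⱼ₊₂ = ⊥-elim (<-asym (remainder-smaller j<t)
                          (subst (_< r (suc j)) (sym rⱼ≡rⱼ₊₂) (next-remainder-smaller j<t)))
  ... | suc _ | _       = s≤s z≤n

  record Admissible (k : ℕ) (z : ℕ → ℕ) : Set where
    field
      vanishes-below : ∀ i → i < k → z i ≡ 0
      bounded        : ∀ i → i ≤ t → z i ≤ Z i
      last-bounded   : z t ≤ Z t ∸ 1
  open Admissible

  Admissible-weaken : ∀ {k z} → Admissible (suc k) z → Admissible k z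
  Admissible-weaken adm = record
    { vanishes-below = λ i i<k → vanishes-below adm i (m≤n⇒m≤1+n i<k)
    ; bounded        = bounded adm
    ; last-bounded   = last-bounded adm
    }

  Admissible-single-⊕ : ∀ {k c z} → k < t → c ≤ Z k →
                        Admissible (suc k) z → Admissible k (single k c ⊕ z)
  Admissible-single-⊕ {k} {c} {z} k<t c≤Zₖ adm = record
    { vanishes-below = λ i i<k → cong₂ _+_ (single-other (<⇒≢ i<k))
                                           (vanishes-below adm i (m≤n⇒m≤1+n i<k))
    ; bounded        = bounded′
    ; last-bounded   = subst (_≤ Z t ∸ 1)
                         (sym (cong (_+ z t) (single-other (λ t≡k → <⇒≢ k<t (sym t≡k)))))
                         (last-bounded adm)
    }
    where
    bounded′ : ∀ i → i ≤ t → single k c i + z i ≤ Z i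
    bounded′ i i≤t with i ≟ k
    ... | yes refl rewrite vanishes-below adm k ≤-refl | +-identityʳ c = c≤Zₖ
    ... | no  _    = bounded adm i i≤t

  -- As z vanishes below j + 1, R(z) = (-1)^j n says that the alternating sum of z,
  -- started with sign + at position j + 1, equals n.
  Represents : ℕ → ℕ → (ℕ → ℕ) → Set
  Represents j n z = Admissible (suc j) z × R t z r ≡ -1ℤ ^ j *ℤ + n × (0 < n → 0 < z (suc j))

  prepend : ∀ {j n c z} → suc j < t → c ≤ Z (suc j) → (0 < n → 0 < c) → Admissible (suc (suc j)) z →
            -1ℤ ^ j *ℤ + (c * r (suc j)) +ℤ R t z r ≡ -1ℤ ^ j *ℤ + n →
            Represents j n (single (suc j) c ⊕ z)
  prepend {j} {n} {c} {z} j+1<t c≤Z c-pos adm value =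
    Admissible-single-⊕ j+1<t c≤Z adm ,
    trans (trans (R-⊕ t (single (suc j) c) z r)
                 (cong (_+ℤ R t z r) (R-single t j c r (<⇒≤ j+1<t)))) value ,
    λ 0<n → subst (0 <_)
              (sym (cong₂ _+_ (single-same (suc j) c) (vanishes-below adm (suc j) ≤-refl)))
              (<-≤-trans (c-pos 0<n) (m≤m+n c 0))

  represent-at-t : ∀ {n} → n < r t → ∃ (Represents t n)
  represent-at-t n<rₜ with n<1⇒n≡0 (subst (_ <_) rt≡1 n<rₜ)
  ... | refl = (λ _ → 0) ,
               record { vanishes-below = λ _ _ → refl ; bounded = λ _ _ → z≤n ; last-bounded = z≤n } ,
               trans (R-vanishes t _ r (λ _ _ _ → refl)) (sym (ℤ.*-zeroʳ (-1ℤ ^ t))) ,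
               λ ()

  -- r_{t-1} = Z_t r_t + r_{t+1} = Z_t, since r_t = 1 forces r_{t+1} = 0.
  represent-at-last : ∀ {j n} → suc j ≡ t → n < r j → ∃ (Represents j n)
  represent-at-last {j} {n} refl n<rⱼ =
    single (suc j) n ,
    record { vanishes-below = λ i i<j+1 → single-other (<⇒≢ i<j+1)
           ; bounded        = λ i _ → single-≤ Z i (<⇒≤ n<Zₜ)
           ; last-bounded   = subst (_≤ Z (suc j) ∸ 1) (sym (single-same (suc j) n)) (<⇒≤pred n<Zₜ)
           } ,
    trans (R-single (suc j) j n r ≤-refl)
          (cong (λ m → -1ℤ ^ j *ℤ + m) (trans (cong (n *_) rt≡1) (*-identityʳ n))) ,
    λ 0<n → subst (0 <_) (sym (single-same (suc j) n)) 0<n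
    where
    rₜ₊₁≡0 : r (suc (suc j)) ≡ 0
    rₜ₊₁≡0 = n<1⇒n≡0 (subst (r (suc (suc j)) <_) rt≡1 (next-remainder-smaller {j} ≤-refl))
    n<Zₜ : n < Z (suc j)
    n<Zₜ = subst (n <_) (trans (division-step ≤-refl)
             (trans (cong₂ (λ a b → Z (suc j) * a + b) rt≡1 rₜ₊₁≡0)
               (trans (+-identityʳ _) (*-identityʳ _)))) n<rⱼ

  represent-step : ∀ {j} → suc j < t →
                   (∀ {e} → e < r (suc j) → ∃ (Represents (suc j) e)) →
                   (∀ {e} → e < r (suc (suc j)) → ∃ (Represents (suc (suc j)) e)) →
                   ∀ {n} → n < r j → ∃ (Represents j n)
  represent-step {j} j+1<t represent₁ represent₂ {n} n<rⱼ with n ≤? Z (suc j) * r (suc j)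
  ... | yes n≤Zr
    with ceiling-multiple (≤-<-trans z≤n (next-remainder-smaller (<⇒≤ j+1<t))) (Z (suc j)) n n≤Zr
  ... | c , e , c≤Z , cr≡n+e , e<r , c-pos with represent₁ e<r
  ... | z , adm , value , _ =
    single (suc j) c ⊕ z ,
    prepend j+1<t c≤Z c-pos adm
      (trans (cong₂ (λ m x → -1ℤ ^ j *ℤ + m +ℤ x) cr≡n+e value) (alternating-cancel j n e))
  represent-step {j} j+1<t represent₁ represent₂ {n} n<rⱼ | no n≰Zr
    with m≤n⇒∃[o]m+o≡n (<⇒≤ (≰⇒> n≰Zr))
  ... | e , Zr+e≡n with represent₂ (+-cancelˡ-< (Z (suc j) * r (suc j)) e _
                         (subst₂ _<_ (sym Zr+e≡n) (division-step (<⇒≤ j+1<t)) n<rⱼ))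
  ... | z , adm , value , _ =
    single (suc j) (Z (suc j)) ⊕ z ,
    prepend j+1<t ≤-refl (λ _ → quotient-positive (<⇒≤ j+1<t)) (Admissible-weaken adm)
      (trans (cong (-1ℤ ^ j *ℤ + (Z (suc j) * r (suc j)) +ℤ_) value)
        (trans (alternating-add j _ e) (cong (λ m → -1ℤ ^ j *ℤ + m) Zr+e≡n)))

  represent : ∀ d {j} → d + j ≡ t → ∀ {n} → n < r j → ∃ (Represents j n)
  represent zero          refl = represent-at-t
  represent (suc zero)    eq   = represent-at-last eq
  represent (suc (suc d)) {j} d+2+j≡t =
    represent-step (subst (suc (suc j) ≤_) d+2+j≡t (s≤s (s≤s (m≤n+m j d))))
      (represent (suc d) d+1+[j+1]≡t) (represent d d+[j+2]≡t)
    where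
    d+1+[j+1]≡t : suc d + suc j ≡ t
    d+1+[j+1]≡t = trans (cong suc (+-suc d j)) d+2+j≡t
    d+[j+2]≡t : d + suc (suc j) ≡ t
    d+[j+2]≡t = trans (+-suc d (suc j)) d+1+[j+1]≡t

  represent-from-start : ∀ {n} → n < r 0 → ∃ (Represents 0 n)
  represent-from-start = represent t (+-identityʳ t)

lemma4 : (p r₁ : ℕ) → 3 ≤ p → 0 < r₁ → r₁ < p → Coprime p r₁ →
         (t : ℕ) (r Z : ℕ → ℕ) → IsEuclid p r₁ t r Z →
         (n : ℕ) → n < p →
         ∃ λ z → InZ t Z z × (+ n ≡ R t z r)
lemma4 p r₁ 3≤p _ _ _ zero r Z (r0≡p , _ , r0≡1 , _) n _ =
  ⊥-elim (<-irrefl (trans (sym r0≡1) r0≡p) (≤-trans (s≤s (s≤s z≤n)) 3≤p))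
lemma4 p r₁ _ _ _ _ (suc t) r Z _ zero _ =
  (λ _ → 0) , ((λ _ _ _ → z≤n) , inj₁ (λ _ _ _ → refl)) ,
  sym (R-vanishes (suc t) _ r (λ _ _ _ → refl))
lemma4 p r₁ _ _ r₁<p _ (suc t) r Z (r0≡p , r1≡r₁ , rt≡1 , division) (suc n) n<p
  with Representation.represent-from-start division (subst₂ _<_ (sym r1≡r₁) (sym r0≡p) r₁<p) rt≡1
         (subst (suc n <_) (sym r0≡p) n<p)
... | z , adm , value , leading =
  z , ((λ i _ → bounded adm i) , inj₂ ((1 , first-nonzero , refl) , last-bounded adm)) ,
  sym (trans value (ℤ.*-identityˡ _))
  where
  open Representation.Admissible
  first-nonzero : FirstNonzeroAt (suc t) z 1
  first-nonzero = ≤-refl , s≤s z≤n , leading (s≤s z≤n) , λ _ 1≤i i<1 → ⊥-elim (<⇒≱ i<1 1≤i)
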